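{- Let $G$ be a bipartite graph with partite vertex sets $V_1,V_2$ where $|V_1|>|V_2|$. Then $G$ is a minimal configuration if and only if $G$ is a slim graph with $\eta(G)=1$ and $CV=V_1$.
   Context: For the $\{0,1\}$-adjacency matrix $\mathbf{A}$ of a graph $G$, $\eta(G)=\dim\ker\mathbf{A}$ and $G$ is singular if $\eta(G)>0$; a vertex $v$ is a core vertex if some $\mathbf{x}\in\ker\mathbf{A}$ has $x_v\neq 0$, and core-forbidden otherwise; $CV$ is the set of core vertices, $CFV$ the set of core-forbidden vertices, and $N(CV)$ the set of vertices adjacent to some core vertex. A slim graph is a connected singular graph whose set $CV$ is independent and whose set $CFV$ is precisely $N(CV)$. A minimal configuration (MC) is a singular graph on vertex set $V$ which is either $K_1$ or, if $|V|\ge3$, has core $F=G[CV]$ and periphery $\mathcal{P}=V\setminus CV$ satisfying: (i) $\eta(G)=1$; (ii) $\mathcal{P}=\emptyset$ or $\mathcal{P}$ induces a graph consisting of isolated vertices; (iii) $|\mathcal{P}|+1=\eta(F)$. -}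

module Defs where

open import Data.Nat using (ℕ; zero; suc; _≤_; _<_)
open import Data.Fin using (Fin; zero; suc)
open import Data.Fin.Subset using (Subset; _∈_; ∁; ∣_∣)
open import Data.Bool using (Bool; true; false)
open import Data.Rational using (ℚ; 0ℚ; 1ℚ; _+_; _*_)
open import Data.Product using (Σ; ∃; ∃-syntax; _×_; _,_)
open import Data.Sum using (_⊎_)
open import Data.Unit using (⊤)
open import Relation.Nullary using (¬_)
open import Relation.Binary.PropositionalEquality using (_≡_; _≢_)
open import Function.Bundles using (_⇔_)

record Graph (n : ℕ) : Set where
  field
    adj    : Fin n → Fin n → Bool
    sym    : ∀ u v → adj u v ≡ adj v u
    irrefl : ∀ v → adj v v ≡ false
open Graph public

Adjacent : ∀ {n} → Graph n → Fin n → Fin n → Set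
Adjacent G u v = adj G u v ≡ true

entry : Bool → ℚ
entry true  = 1ℚ
entry false = 0ℚ

A : ∀ {n} → Graph n → Fin n → Fin n → ℚ
A G i j = entry (adj G i j)

∑ : ∀ {n} → (Fin n → ℚ) → ℚ
∑ {zero}  f = 0ℚ
∑ {suc n} f = f zero + ∑ (λ i → f (suc i))

-- Kernel of the principal submatrix of A indexed by the vertex set S
-- (S = everything gives ker A; general S gives ker of A[S], i.e. the
-- induced subgraph G[S]); vectors are indexed by Fin n and vanish off S.
KerVecOn : ∀ {n} → Graph n → (Fin n → Set) → (Fin n → ℚ) → Set
KerVecOn {n} G S x =
  (∀ v → ¬ S v → x v ≡ 0ℚ) × (∀ i → S i → ∑ (λ j → A G i j * x j) ≡ 0ℚ)

LinIndep : ∀ {n k} → (Fin k → Fin n → ℚ) → Set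
LinIndep {n} {k} vs =
  ∀ (c : Fin k → ℚ) → (∀ j → ∑ (λ i → c i * vs i j) ≡ 0ℚ) → ∀ i → c i ≡ 0ℚ

IndepKerFamilyOn : ∀ {n} → Graph n → (Fin n → Set) → (k : ℕ) → Set
IndepKerFamilyOn {n} G S k =
  Σ (Fin k → Fin n → ℚ) λ vs → (∀ i → KerVecOn G S (vs i)) × LinIndep vs

NullityOn : ∀ {n} → Graph n → (Fin n → Set) → ℕ → Set
NullityOn G S k =
  IndepKerFamilyOn G S k × (∀ m → IndepKerFamilyOn G S m → m ≤ k)

All : ∀ {n} → Fin n → Set
All _ = ⊤

Nullity : ∀ {n} → Graph n → ℕ → Set
Nullity G k = NullityOn G All k

Singular : ∀ {n} → Graph n → Set
Singular G = ∃[ k ] (Nullity G k × 0 < k)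

CoreVertex : ∀ {n} → Graph n → Fin n → Set
CoreVertex G v = ∃[ x ] (KerVecOn G All x × x v ≢ 0ℚ)

CoreForbidden : ∀ {n} → Graph n → Fin n → Set
CoreForbidden G v = ¬ CoreVertex G v

HasCard : ∀ {n} → (Fin n → Set) → ℕ → Set
HasCard {n} P k = Σ (Subset n) λ s → (∀ v → (v ∈ s) ⇔ P v) × ∣ s ∣ ≡ k

data Reach {n} (G : Graph n) : Fin n → Fin n → Set where
  here  : ∀ {v} → Reach G v v
  there : ∀ {u w v} → Adjacent G u w → Reach G w v → Reach G u v

Connected : ∀ {n} → Graph n → Set
Connected G = ∀ u v → Reach G u v

Independent : ∀ {n} → Graph n → (Fin n → Set) → Set
Independent G P = ∀ u v → P u → P v → ¬ Adjacent G u v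

NeighbourOfCore : ∀ {n} → Graph n → Fin n → Set
NeighbourOfCore G v = ∃[ u ] (CoreVertex G u × Adjacent G u v)

Slim : ∀ {n} → Graph n → Set
Slim G = Connected G × Singular G × Independent G (CoreVertex G)
         × (∀ v → CoreForbidden G v ⇔ NeighbourOfCore G v)

MinimalConfiguration : ∀ {n} → Graph n → Set
MinimalConfiguration {n} G =
  Singular G ×
  (n ≡ 1 ⊎
   (3 ≤ n × Nullity G 1 × Independent G (CoreForbidden G) ×
    ∃[ p ] (HasCard (CoreForbidden G) p × NullityOn G (CoreVertex G) (suc p))))

-- V1 = s, V2 = ∁ s is a bipartition of G
Bipartition : ∀ {n} → Graph n → Subset n → Set
Bipartition G s = ∀ u v → Adjacent G u v → (u ∈ s × ¬ v ∈ s) ⊎ (¬ u ∈ s × v ∈ s)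

-- A vector supported on V₁ lies in ker A as soon as it is orthogonal to the ∣ V₂ ∣ rows indexed by V₂,
-- so η(G) ≥ ∣ V₁ ∣ - ∣ V₂ ∣ ≥ 1 and some kernel vector x₀ is supported on V₁. If η(G) = 1, every kernel
-- vector is a multiple of x₀: hence CV ⊆ V₁, ∣ V₁ ∣ = ∣ V₂ ∣ + 1, no vertex of V₂ is isolated, and when
-- CV = V₁ the graph is connected, since restricting x₀ to two components would give two independent
-- kernel vectors. Slimness then follows from bipartiteness; conversely G[V₁] is edgeless, so
-- η(G[CV]) = ∣ V₁ ∣ = ∣ CFV ∣ + 1. In a minimal configuration a non-core vertex of V₁ is impossible by
-- counting: it would leave ∣ CV ∣ ≤ ∣ V₂ ∣, too few to carry η(G[CV]) = n - ∣ CV ∣ + 1.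

module Submission where

open import Defs hiding (sym)
open import Data.Nat using (ℕ; _>_; zero; suc; _≤_; _<_; s≤s; _∸_)
  renaming (_+_ to _+ℕ_)
import Data.Nat.Properties as ℕ
open import Data.Fin using (Fin; zero; suc; punchIn)
import Data.Fin.Properties as Fin
open import Data.Fin.Subset using (Subset; _∈_; _∉_; ∁; ∣_∣; inside; outside; ⊤; _∪_; ⁅_⁆)
open import Data.Fin.Subset.Properties
  using (_∈?_; ∈⊤; ⊆⊤; ∣⊤∣≡n; ∣p∣≤n; ∣∁p∣≡n∸∣p∣; ∣⁅x⁆∣≡1; x∉p⇒x∈∁p; x∈∁p⇒x∉p; x∉∁p⇒x∈p; x∈p⇒x∉∁p;
         p⊂q⇒∣p∣<∣q∣; p⊆p∪q; x∈p∪q⁻; x∈p∪q⁺; x∈⁅x⁆; x∈⁅y⁆⇒x≡y)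
open import Data.Vec using (_∷_; []; here; there)
open import Data.Vec.Functional using (Vector; insertAt)
import Data.Vec.Functional as Vector
open import Data.Vec.Functional.Properties using (insertAt-lookup; insertAt-punchIn)
open import Data.Bool using (true)
import Data.Bool as Bool
open import Data.Bool.Properties using (¬-not)
open import Data.Rational using (ℚ; 0ℚ; 1ℚ; _+_; _*_; -_; 1/_; ≢-nonZero)
open import Data.Rational.Properties
  using (_≟_; 1≢0; +-identityˡ; +-identityʳ; *-zeroˡ; *-zeroʳ; *-identityˡ; *-identityʳ; *-comm; *-assoc;
         *-distribˡ-+; *-inverseˡ)
open import Data.Rational.Solver using (module +-*-Solver)
open import Data.Product using (Σ; ∃-syntax; _×_; _,_; proj₁; proj₂)
open import Data.Sum using (_⊎_; inj₁; inj₂; [_,_]′)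
open import Data.Empty using (⊥; ⊥-elim)
open import Data.Unit using (tt)
open import Relation.Nullary using (¬_; Dec; yes; no; contradiction)
open import Relation.Nullary.Decidable using (_×-dec_; ¬?; decidable-stable)
open import Relation.Binary.PropositionalEquality
  using (_≡_; _≢_; refl; sym; trans; cong; cong₂; subst; subst₂; module ≡-Reasoning)
open import Function using (_∘_)
open import Function.Bundles using (_⇔_; mk⇔; Equivalence)

∑-cong : ∀ {k} {f g : Fin k → ℚ} → (∀ i → f i ≡ g i) → ∑ f ≡ ∑ g
∑-cong {zero}  f≡g = refl
∑-cong {suc k} f≡g = cong₂ _+_ (f≡g zero) (∑-cong (f≡g ∘ suc))

∑-zero : ∀ {k} {f : Fin k → ℚ} → (∀ i → f i ≡ 0ℚ) → ∑ f ≡ 0ℚ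
∑-zero {zero}  f≡0 = refl
∑-zero {suc k} f≡0 = trans (cong₂ _+_ (f≡0 zero) (∑-zero (f≡0 ∘ suc))) (+-identityˡ 0ℚ)

∑-distrib-+ : ∀ {k} (f g : Fin k → ℚ) → ∑ (λ i → f i + g i) ≡ ∑ f + ∑ g
∑-distrib-+ {zero}  f g = refl
∑-distrib-+ {suc k} f g =
  trans (cong (f zero + g zero +_) (∑-distrib-+ (f ∘ suc) (g ∘ suc)))
        (interchange (f zero) (g zero) (∑ (f ∘ suc)) (∑ (g ∘ suc)))
  where
  open +-*-Solver
  interchange : ∀ a b c d → a + b + (c + d) ≡ a + c + (b + d)
  interchange = solve 4 (λ a b c d → (a :+ b) :+ (c :+ d) := (a :+ c) :+ (b :+ d)) refl

∑-*ˡ : ∀ {k} (a : ℚ) (f : Fin k → ℚ) → ∑ (λ i → a * f i) ≡ a * ∑ f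
∑-*ˡ {zero}  a f = sym (*-zeroʳ a)
∑-*ˡ {suc k} a f =
  trans (cong (a * f zero +_) (∑-*ˡ a (f ∘ suc))) (sym (*-distribˡ-+ a (f zero) (∑ (f ∘ suc))))

∑-punchIn : ∀ {k} (i : Fin (suc k)) (f : Fin (suc k) → ℚ) → ∑ f ≡ f i + ∑ (f ∘ punchIn i)
∑-punchIn zero    f = refl
∑-punchIn {suc k} (suc i) f =
  trans (cong (f zero +_) (∑-punchIn i (f ∘ suc))) (swap (f zero) (f (suc i)) (∑ (f ∘ suc ∘ punchIn i)))
  where
  open +-*-Solver
  swap : ∀ a b c → a + (b + c) ≡ b + (a + c)
  swap = solve 3 (λ a b c → a :+ (b :+ c) := b :+ (a :+ c)) refl

∑-*-affine : ∀ {d} (c x t : Fin d → ℚ) (y : ℚ) →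
             ∑ (λ j → c j * (x j + t j * y)) ≡ ∑ (λ j → c j * t j) * y + ∑ (λ j → c j * x j)
∑-*-affine c x t y = begin
  ∑ (λ j → c j * (x j + t j * y))          ≡⟨ ∑-cong (λ j → expand (c j) (x j) (t j) y) ⟩
  ∑ (λ j → c j * x j + y * (c j * t j))    ≡⟨ ∑-distrib-+ (λ j → c j * x j) (λ j → y * (c j * t j)) ⟩
  ∑ (λ j → c j * x j) + ∑ (λ j → y * (c j * t j))
                                           ≡⟨ cong (∑ (λ j → c j * x j) +_) (∑-*ˡ y (λ j → c j * t j)) ⟩
  ∑ (λ j → c j * x j) + y * ∑ (λ j → c j * t j)
                                           ≡⟨ swap (∑ (λ j → c j * x j)) y (∑ (λ j → c j * t j)) ⟩
  ∑ (λ j → c j * t j) * y + ∑ (λ j → c j * x j) ∎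
  where
  open ≡-Reasoning
  open +-*-Solver
  expand : ∀ c x t y → c * (x + t * y) ≡ c * x + y * (c * t)
  expand = solve 4 (λ c x t y → c :* (x :+ t :* y) := c :* x :+ y :* (c :* t)) refl
  swap : ∀ a y b → a + y * b ≡ b * y + a
  swap = solve 3 (λ a y b → a :+ y :* b := b :* y :+ a) refl

x*y≡0⇒x≢0⇒y≡0 : ∀ x y → x * y ≡ 0ℚ → x ≢ 0ℚ → y ≡ 0ℚ
x*y≡0⇒x≢0⇒y≡0 x y xy≡0 x≢0 = begin
  y                 ≡⟨ sym (*-identityˡ y) ⟩
  1ℚ * y            ≡⟨ cong (_* y) (sym (*-inverseˡ x {{≢-nonZero x≢0}})) ⟩
  (x⁻¹ * x) * y     ≡⟨ *-assoc x⁻¹ x y ⟩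
  x⁻¹ * (x * y)     ≡⟨ cong (x⁻¹ *_) xy≡0 ⟩
  x⁻¹ * 0ℚ          ≡⟨ *-zeroʳ x⁻¹ ⟩
  0ℚ                ∎
  where
  open ≡-Reasoning
  x⁻¹ = (1/ x) {{≢-nonZero x≢0}}

∣p∣+∣∁p∣≡n : ∀ {n} (p : Subset n) → ∣ p ∣ +ℕ ∣ ∁ p ∣ ≡ n
∣p∣+∣∁p∣≡n p = trans (cong (∣ p ∣ +ℕ_) (∣∁p∣≡n∸∣p∣ p)) (ℕ.m+[n∸m]≡n (∣p∣≤n p))

p<c≤q⇒p+c≢1+q+q : ∀ {p c q} → suc p ≤ c → c ≤ q → p +ℕ c ≢ suc q +ℕ q
p<c≤q⇒p+c≢1+q+q {p} {c} {q} p<c c≤q p+c≡ = ℕ.<-irrefl refl (begin-strict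
  suc q +ℕ q  ≡⟨ sym p+c≡ ⟩
  p +ℕ c      <⟨ ℕ.+-monoˡ-< c p<c ⟩
  c +ℕ c      ≤⟨ ℕ.+-mono-≤ c≤q c≤q ⟩
  q +ℕ q      <⟨ ℕ.n<1+n _ ⟩
  suc q +ℕ q  ∎)
  where open ℕ.≤-Reasoning

Fin-singleton : ∀ {n} → n ≡ 1 → (i j : Fin n) → i ≡ j
Fin-singleton refl zero zero = refl

infix 8 _·_
_·_ : ∀ {k} → Vector ℚ k → Vector ℚ k → ℚ
e · x = ∑ (λ j → e j * x j)

·-comm : ∀ {k} (e x : Vector ℚ k) → e · x ≡ x · e
·-comm e x = ∑-cong (λ j → *-comm (e j) (x j))

infixl 6 _+⟨_⟩_
_+⟨_⟩_ : ∀ {k} → Vector ℚ k → ℚ → Vector ℚ k → Vector ℚ k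
(x +⟨ t ⟩ y) v = x v + t * y v

·-linear : ∀ {k} (e x y : Vector ℚ k) t → e · (x +⟨ t ⟩ y) ≡ e · x + t * (e · y)
·-linear e x y t = begin
  ∑ (λ j → e j * (x j + t * y j))        ≡⟨ ∑-cong (λ j → distrib (e j) (x j) (y j) t) ⟩
  ∑ (λ j → e j * x j + t * (e j * y j))  ≡⟨ ∑-distrib-+ (λ j → e j * x j) (λ j → t * (e j * y j)) ⟩
  e · x + ∑ (λ j → t * (e j * y j))      ≡⟨ cong (e · x +_) (∑-*ˡ t (λ j → e j * y j)) ⟩
  e · x + t * (e · y)                    ∎
  where
  open ≡-Reasoning
  open +-*-Solver
  distrib : ∀ a b c t → a * (b + t * c) ≡ a * b + t * (a * c)
  distrib = solve 4 (λ a b c t → a :* (b :+ t :* c) := a :* b :+ t :* (a :* c)) refl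

record Subspace {k} (P : Vector ℚ k → Set) : Set where
  field
    +⟨⟩-closed : ∀ {x y} t → P x → P y → P (x +⟨ t ⟩ y)
open Subspace

∩-subspace : ∀ {k} {P Q : Vector ℚ k → Set} → Subspace P → Subspace Q → Subspace (λ x → P x × Q x)
∩-subspace P-sub Q-sub .+⟨⟩-closed t (px , qx) (py , qy) =
  P-sub .+⟨⟩-closed t px py , Q-sub .+⟨⟩-closed t qx qy

annihilator-subspace : ∀ {k} (e : Vector ℚ k) → Subspace (λ x → e · x ≡ 0ℚ)
annihilator-subspace e .+⟨⟩-closed {x} {y} t ex≡0 ey≡0 = begin
  e · (x +⟨ t ⟩ y)     ≡⟨ ·-linear e x y t ⟩
  e · x + t * (e · y)  ≡⟨ cong₂ (λ a b → a + t * b) ex≡0 ey≡0 ⟩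
  0ℚ + t * 0ℚ          ≡⟨ trans (+-identityˡ _) (*-zeroʳ t) ⟩
  0ℚ                   ∎
  where open ≡-Reasoning

SupportedOn : ∀ {k} → Subset k → Vector ℚ k → Set
SupportedOn S x = ∀ v → v ∉ S → x v ≡ 0ℚ

SupportedOn-subspace : ∀ {k} (S : Subset k) → Subspace (SupportedOn S)
SupportedOn-subspace S .+⟨⟩-closed {x} {y} t x-supp y-supp v v∉S =
  trans (cong₂ (λ a b → a + t * b) (x-supp v v∉S) (y-supp v v∉S))
        (trans (+-identityˡ _) (*-zeroʳ t))

Orthogonal : ∀ {k m} → (Fin m → Vector ℚ k) → Subset m → Vector ℚ k → Set
Orthogonal E T x = ∀ r → r ∈ T → E r · x ≡ 0ℚ

Orthogonal-subspace : ∀ {k m} (E : Fin m → Vector ℚ k) (T : Subset m) → Subspace (Orthogonal E T)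
Orthogonal-subspace E T .+⟨⟩-closed t x⊥ y⊥ r r∈T =
  annihilator-subspace (E r) .+⟨⟩-closed t (x⊥ r r∈T) (y⊥ r r∈T)

-- IndepFamilyIn (KerVecOn G S) d is definitionally IndepKerFamilyOn G S d.
IndepFamilyIn : ∀ {k} → (Vector ℚ k → Set) → ℕ → Set
IndepFamilyIn {k} P d = Σ (Fin d → Vector ℚ k) λ vs → (∀ i → P (vs i)) × LinIndep vs

IndepFamilyIn-mono : ∀ {k d} {P Q : Vector ℚ k → Set} → (∀ x → P x → Q x) →
                     IndepFamilyIn P d → IndepFamilyIn Q d
IndepFamilyIn-mono P⇒Q (vs , vs∈P , ind) = vs , (λ i → P⇒Q (vs i) (vs∈P i)) , ind

LinIndep-tail : ∀ {k d} (W : Fin (suc d) → Vector ℚ k) → LinIndep W → LinIndep (W ∘ suc)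
LinIndep-tail W ind c c·W≡0 i = ind (0ℚ Vector.∷ c) dep (suc i)
  where
  dep : ∀ j → 0ℚ * W zero j + ∑ (λ i → c i * W (suc i) j) ≡ 0ℚ
  dep j = trans (cong (_+ ∑ (λ i → c i * W (suc i) j)) (*-zeroˡ (W zero j))) (trans (+-identityˡ _) (c·W≡0 j))

LinIndep-singleton⇒nonzero : ∀ {k} (v : Fin 1 → Vector ℚ k) → LinIndep v → ∃[ w ] v zero w ≢ 0ℚ
LinIndep-singleton⇒nonzero v ind with Fin.any? (λ w → ¬? (v zero w ≟ 0ℚ))
... | yes nonzero = nonzero
... | no  allZero = contradiction (ind (λ _ → 1ℚ) v≡0 zero) 1≢0
  where
  v≡0 : ∀ j → 1ℚ * v zero j + 0ℚ ≡ 0ℚ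
  v≡0 j = trans (+-identityʳ _) (trans (*-identityˡ _)
                (decidable-stable (v zero j ≟ 0ℚ) (λ v≢0 → allZero (j , v≢0))))

LinIndep-pair : ∀ {k} (y z : Vector ℚ k) {w₁ w₂} → y w₁ ≢ 0ℚ → z w₁ ≡ 0ℚ → z w₂ ≢ 0ℚ →
                LinIndep (y Vector.∷ z Vector.∷ Vector.[])
LinIndep-pair y z {w₁} {w₂} y≢0 z≡0 z≢0 c dep = λ { zero → c₀≡0 ; (suc zero) → c₁≡0 }
  where
  open ≡-Reasoning
  c₀ = c zero
  c₁ = c (suc zero)
  c₀≡0 : c₀ ≡ 0ℚ
  c₀≡0 = x*y≡0⇒x≢0⇒y≡0 (y w₁) c₀ (trans (*-comm (y w₁) c₀) (begin
    c₀ * y w₁                         ≡⟨ sym (+-identityʳ _) ⟩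
    c₀ * y w₁ + 0ℚ                    ≡⟨ cong (c₀ * y w₁ +_) (sym (trans (+-identityʳ _)
                                           (trans (cong (c₁ *_) z≡0) (*-zeroʳ c₁)))) ⟩
    c₀ * y w₁ + (c₁ * z w₁ + 0ℚ)      ≡⟨ dep w₁ ⟩
    0ℚ                                ∎)) y≢0
  c₁≡0 : c₁ ≡ 0ℚ
  c₁≡0 = x*y≡0⇒x≢0⇒y≡0 (z w₂) c₁ (trans (*-comm (z w₂) c₁) (begin
    c₁ * z w₂                         ≡⟨ sym (trans (+-identityˡ _) (+-identityʳ _)) ⟩
    0ℚ + (c₁ * z w₂ + 0ℚ)             ≡⟨ cong (_+ _) (sym (trans (cong (_* y w₂) c₀≡0) (*-zeroˡ (y w₂)))) ⟩
    c₀ * y w₂ + (c₁ * z w₂ + 0ℚ)      ≡⟨ dep w₂ ⟩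
    0ℚ                                ∎)) z≢0

-- One step of Gaussian elimination: pivot on a member of the family on which e does not vanish.
eliminate : ∀ {k d} {P : Vector ℚ k → Set} → Subspace P → (e : Vector ℚ k) →
            IndepFamilyIn P (suc d) → IndepFamilyIn (λ x → P x × e · x ≡ 0ℚ) d
eliminate {k} {d} {P} P-sub e (W , W∈P , ind) with Fin.any? (λ i → ¬? (e · W i ≟ 0ℚ))
... | no allZero = W ∘ suc , (λ i → W∈P (suc i) , e·W≡0 (suc i)) , LinIndep-tail W ind
  where
  e·W≡0 : ∀ i → e · W i ≡ 0ℚ
  e·W≡0 i = decidable-stable (e · W i ≟ 0ℚ) (λ e·W≢0 → allZero (i , e·W≢0))
... | yes (p , e·Wp≢0) = vs , (λ j → P-sub .+⟨⟩-closed (t j) (W∈P _) (W∈P p) , e·vs≡0 j) , vs-indep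
  where
  b = e · W p
  b⁻¹ = (1/ b) {{≢-nonZero e·Wp≢0}}
  t : Fin d → ℚ
  t j = - (e · W (punchIn p j) * b⁻¹)
  vs : Fin d → Vector ℚ k
  vs j = W (punchIn p j) +⟨ t j ⟩ W p

  e·vs≡0 : ∀ j → e · vs j ≡ 0ℚ
  e·vs≡0 j = begin
    e · vs j                 ≡⟨ ·-linear e (W (punchIn p j)) (W p) (t j) ⟩
    a + - (a * b⁻¹) * b      ≡⟨ reassoc a b⁻¹ b ⟩
    a + - a * (b⁻¹ * b)      ≡⟨ cong (λ u → a + - a * u) (*-inverseˡ b {{≢-nonZero e·Wp≢0}}) ⟩
    a + - a * 1ℚ             ≡⟨ cancel a ⟩
    0ℚ                       ∎
    where
    open ≡-Reasoning
    open +-*-Solver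
    a = e · W (punchIn p j)
    reassoc : ∀ a b⁻¹ b → a + - (a * b⁻¹) * b ≡ a + - a * (b⁻¹ * b)
    reassoc = solve 3 (λ a b⁻¹ b → a :+ (:- (a :* b⁻¹)) :* b := a :+ (:- a) :* (b⁻¹ :* b)) refl
    cancel : ∀ a → a + - a * 1ℚ ≡ 0ℚ
    cancel = solve 1 (λ a → a :+ (:- a) :* con 1ℚ := con 0ℚ) refl

  -- A relation c among the vs is the relation insertAt c p (∑ c t) among the W.
  vs-indep : LinIndep vs
  vs-indep c c·vs≡0 j = trans (sym (insertAt-punchIn c p T j)) (ind c′ c′·W≡0 (punchIn p j))
    where
    T = ∑ (λ j → c j * t j)
    c′ = insertAt c p T
    c′·W≡0 : ∀ v → ∑ (λ i → c′ i * W i v) ≡ 0ℚ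
    c′·W≡0 v = begin
      ∑ (λ i → c′ i * W i v)
        ≡⟨ ∑-punchIn p (λ i → c′ i * W i v) ⟩
      c′ p * W p v + ∑ (λ j → c′ (punchIn p j) * W (punchIn p j) v)
        ≡⟨ cong₂ _+_ (cong (_* W p v) (insertAt-lookup c p T))
                     (∑-cong (λ j → cong (_* W (punchIn p j) v) (insertAt-punchIn c p T j))) ⟩
      T * W p v + ∑ (λ j → c j * W (punchIn p j) v)
        ≡⟨ sym (∑-*-affine c (λ j → W (punchIn p j) v) t (W p v)) ⟩
      ∑ (λ j → c j * vs j v)
        ≡⟨ c·vs≡0 v ⟩
      0ℚ ∎
      where open ≡-Reasoning

cutByFunctionals : ∀ {k m d} {P : Vector ℚ k → Set} → Subspace P →
                   (E : Fin m → Vector ℚ k) (T : Subset m) →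
                   IndepFamilyIn P (∣ T ∣ +ℕ d) → IndepFamilyIn (λ x → P x × Orthogonal E T x) d
cutByFunctionals {P = P} P-sub E [] = IndepFamilyIn-mono extend
  where
  extend : ∀ x → P x → P x × Orthogonal E [] x
  extend _ px = px , λ ()
cutByFunctionals {P = P} P-sub E (outside ∷ T) fam =
  IndepFamilyIn-mono extend (cutByFunctionals P-sub (E ∘ suc) T fam)
  where
  extend : ∀ x → P x × Orthogonal (E ∘ suc) T x → P x × Orthogonal E (outside ∷ T) x
  extend _ (px , x⊥) = px , λ { zero () ; (suc r) (there r∈T) → x⊥ r r∈T }
cutByFunctionals {d = d} {P} P-sub E (inside ∷ T) fam =
  IndepFamilyIn-mono extend
    (eliminate (∩-subspace P-sub (Orthogonal-subspace (E ∘ suc) T)) (E zero)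
      (cutByFunctionals P-sub (E ∘ suc) T (subst (IndepFamilyIn P) (sym (ℕ.+-suc ∣ T ∣ d)) fam)))
  where
  extend : ∀ x → (P x × Orthogonal (E ∘ suc) T x) × E zero · x ≡ 0ℚ → P x × Orthogonal E (inside ∷ T) x
  extend _ ((px , x⊥) , e·x≡0) = px , λ { zero here → e·x≡0 ; (suc r) (there r∈T) → x⊥ r r∈T }

standardBasis : ∀ {k} (S : Subset k) d → d ≤ ∣ S ∣ → IndepFamilyIn (SupportedOn S) d
standardBasis [] zero _ = (λ ()) , (λ ()) , λ _ _ ()
standardBasis (outside ∷ S) d d≤∣S∣ with standardBasis S d d≤∣S∣
... | vs , vs-supp , ind = (λ i → 0ℚ Vector.∷ vs i) , supp , λ c dep → ind c (dep ∘ suc)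
  where
  supp : ∀ i → SupportedOn (outside ∷ S) (0ℚ Vector.∷ vs i)
  supp i zero    _   = refl
  supp i (suc v) v∉S = vs-supp i v (v∉S ∘ there)
standardBasis (inside ∷ S) zero _ = (λ ()) , (λ ()) , λ _ _ ()
standardBasis (inside ∷ S) (suc d) (s≤s d≤∣S∣) with standardBasis S d d≤∣S∣
... | vs , vs-supp , ind = ws , supp , ws-indep
  where
  ws : Fin (suc d) → Vector ℚ _
  ws = (1ℚ Vector.∷ λ _ → 0ℚ) Vector.∷ λ i → 0ℚ Vector.∷ vs i
  supp : ∀ i → SupportedOn (inside ∷ S) (ws i)
  supp i       zero    v∉S = contradiction here v∉S
  supp zero    (suc v) _   = refl
  supp (suc i) (suc v) v∉S = vs-supp i v (v∉S ∘ there)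
  ws-indep : LinIndep ws
  ws-indep c dep zero = begin
    c zero                                  ≡⟨ sym (trans (+-identityʳ _) (*-identityʳ _)) ⟩
    c zero * 1ℚ + 0ℚ                        ≡⟨ cong (c zero * 1ℚ +_) (sym (∑-zero (λ i → *-zeroʳ (c (suc i))))) ⟩
    c zero * 1ℚ + ∑ (λ i → c (suc i) * 0ℚ)  ≡⟨ dep zero ⟩
    0ℚ                                      ∎
    where open ≡-Reasoning
  ws-indep c dep (suc i) = ind (c ∘ suc) (λ j → trans (sym (+-identityˡ _))
    (trans (cong (_+ ∑ (λ i → c (suc i) * vs i j)) (sym (*-zeroʳ (c zero)))) (dep (suc j)))) i

-- A family of more than ∣ S ∣ vectors supported on S would, read by columns, give ∣ S ∣ equations
-- in more unknowns, hence a nontrivial linear relation.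
IndepFamily-supported⇒≤ : ∀ {k m} (S : Subset k) → IndepFamilyIn (SupportedOn S) m → m ≤ ∣ S ∣
IndepFamily-supported⇒≤ {m = m} S (vs , vs-supp , ind) with m ℕ.≤? ∣ S ∣
... | yes m≤∣S∣ = m≤∣S∣
... | no  m≰∣S∣ = contradiction (ind c c·vs≡0 w) c-w≢0
  where
  ∣S∣+1≤m : ∣ S ∣ +ℕ 1 ≤ ∣ ⊤ {m} ∣
  ∣S∣+1≤m = subst₂ _≤_ (ℕ.+-comm 1 ∣ S ∣) (sym (∣⊤∣≡n m)) (ℕ.≰⇒> m≰∣S∣)
  relation = cutByFunctionals (SupportedOn-subspace ⊤) (λ j i → vs i j) S
               (standardBasis ⊤ (∣ S ∣ +ℕ 1) ∣S∣+1≤m)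
  c : Vector ℚ m
  c = proj₁ relation zero
  nonzero = LinIndep-singleton⇒nonzero (proj₁ relation) (proj₂ (proj₂ relation))
  w = proj₁ nonzero
  c-w≢0 = proj₂ nonzero
  c·vs≡0 : ∀ j → ∑ (λ i → c i * vs i j) ≡ 0ℚ
  c·vs≡0 j with j ∈? S
  ... | yes j∈S = trans (·-comm c (λ i → vs i j)) (proj₂ (proj₁ (proj₂ relation) zero) j j∈S)
  ... | no  j∉S = ∑-zero (λ i → trans (cong (c i *_) (vs-supp i j j∉S)) (*-zeroʳ (c i)))

Adjacent-sym : ∀ {n} (G : Graph n) {u v} → Adjacent G u v → Adjacent G v u
Adjacent-sym G {u} {v} uv = trans (Graph.sym G v u) uv

A≡0 : ∀ {n} (G : Graph n) {i j} → ¬ Adjacent G i j → A G i j ≡ 0ℚ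
A≡0 G ¬ij = cong entry (¬-not ¬ij)

Reach-snoc : ∀ {n} {G : Graph n} {u v w} → Reach G u v → Adjacent G v w → Reach G u w
Reach-snoc here         vw = there vw here
Reach-snoc (there uv r) vw = there uv (Reach-snoc r vw)

module _ {n} (G : Graph n) where

  Closed : Subset n → Set
  Closed R = ∀ {u v} → u ∈ R → Adjacent G u v → v ∈ R

  ∁-closed : ∀ {R} → Closed R → Closed (∁ R)
  ∁-closed {R} R-closed {u} {v} u∈∁R uv with v ∈? R
  ... | yes v∈R = contradiction (R-closed v∈R (Adjacent-sym G uv)) (x∈∁p⇒x∉p u∈∁R)
  ... | no  v∉R = x∉p⇒x∈∁p v∉R

  Component : Fin n → Set
  Component u = Σ (Subset n) λ R → u ∈ R × Closed R × (∀ {v} → v ∈ R → Reach G u v)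

  private
    LeavingEdge : Subset n → Set
    LeavingEdge R = ∃[ v ] ∃[ w ] (v ∈ R × Adjacent G v w × w ∉ R)

    leavingEdge? : ∀ R → Dec (LeavingEdge R)
    leavingEdge? R = Fin.any? λ v → Fin.any? λ w → v ∈? R ×-dec (adj G v w Bool.≟ true) ×-dec ¬? (w ∈? R)

    closed-if-no-leavingEdge : ∀ R → ¬ LeavingEdge R → Closed R
    closed-if-no-leavingEdge R none {v} {w} v∈R vw =
      decidable-stable (w ∈? R) (λ w∉R → none (v , w , v∈R , vw , w∉R))

    -- Each step adds a vertex, so fuel n suffices.
    grow : ∀ {u} fuel R → u ∈ R → (∀ {v} → v ∈ R → Reach G u v) → n ≤ ∣ R ∣ +ℕ fuel → Component u
    grow fuel R u∈R reach n≤ with leavingEdge? R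
    ... | no none = R , u∈R , closed-if-no-leavingEdge R none , reach
    grow zero R u∈R reach n≤ | yes (v , w , v∈R , vw , w∉R) =
      contradiction (ℕ.≤-trans n≤ (ℕ.≤-reflexive (ℕ.+-identityʳ ∣ R ∣))) (ℕ.<⇒≱ ∣R∣<n)
      where
      ∣R∣<n : ∣ R ∣ < n
      ∣R∣<n = subst (∣ R ∣ <_) (∣⊤∣≡n n) (p⊂q⇒∣p∣<∣q∣ (⊆⊤ , w , ∈⊤ , w∉R))
    grow {u} (suc fuel) R u∈R reach n≤ | yes (v , w , v∈R , vw , w∉R) =
      grow fuel (R ∪ ⁅ w ⁆) (p⊆p∪q _ u∈R) reach′ n≤′
      where
      reach′ : ∀ {x} → x ∈ R ∪ ⁅ w ⁆ → Reach G u x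
      reach′ {x} x∈ with x∈p∪q⁻ R ⁅ w ⁆ x∈
      ... | inj₁ x∈R = reach x∈R
      ... | inj₂ x∈⁅w⁆ = subst (Reach G u) (sym (x∈⁅y⁆⇒x≡y w x∈⁅w⁆)) (Reach-snoc (reach v∈R) vw)
      ∣R∣<∣R∪w∣ : ∣ R ∣ < ∣ R ∪ ⁅ w ⁆ ∣
      ∣R∣<∣R∪w∣ = p⊂q⇒∣p∣<∣q∣ (p⊆p∪q _ , w , x∈p∪q⁺ (inj₂ (x∈⁅x⁆ w)) , w∉R)
      n≤′ : n ≤ ∣ R ∪ ⁅ w ⁆ ∣ +ℕ fuel
      n≤′ = ℕ.≤-trans n≤ (subst (_≤ ∣ R ∪ ⁅ w ⁆ ∣ +ℕ fuel) (sym (ℕ.+-suc ∣ R ∣ fuel))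
                                (ℕ.+-monoˡ-≤ fuel ∣R∣<∣R∪w∣))

  component : ∀ u → Component u
  component u =
    grow n ⁅ u ⁆ (x∈⁅x⁆ u) (λ v∈⁅u⁆ → subst (Reach G u) (sym (x∈⁅y⁆⇒x≡y u v∈⁅u⁆)) here) (ℕ.m≤n+m n _)

  InKernel : Vector ℚ n → Set
  InKernel = KerVecOn G All

  inKernel : ∀ {x} → (∀ i → A G i · x ≡ 0ℚ) → InKernel x
  inKernel A·x≡0 = (λ _ ¬⊤ → contradiction tt ¬⊤) , λ i _ → A·x≡0 i

  A·supported≡0 : ∀ {S x i} → SupportedOn S x → (∀ {j} → j ∈ S → ¬ Adjacent G i j) → A G i · x ≡ 0ℚ
  A·supported≡0 {S} {x} {i} x-supp no-edge = ∑-zero term≡0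
    where
    term≡0 : ∀ j → A G i j * x j ≡ 0ℚ
    term≡0 j with j ∈? S
    ... | yes j∈S = trans (cong (_* x j) (A≡0 G (no-edge j∈S))) (*-zeroˡ (x j))
    ... | no  j∉S = trans (cong (A G i j *_) (x-supp j j∉S)) (*-zeroʳ (A G i j))

  restrict : Subset n → Vector ℚ n → Vector ℚ n
  restrict R x v with v ∈? R
  ... | yes _ = x v
  ... | no  _ = 0ℚ

  restrict-∈ : ∀ R x {v} → v ∈ R → restrict R x v ≡ x v
  restrict-∈ R x {v} v∈R with v ∈? R
  ... | yes _   = refl
  ... | no  v∉R = contradiction v∈R v∉R

  restrict-∉ : ∀ R x → SupportedOn R (restrict R x)
  restrict-∉ R x v v∉R with v ∈? R
  ... | yes v∈R = contradiction v∈R v∉R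
  ... | no  _   = refl

  restrict-InKernel : ∀ {R x} → Closed R → InKernel x → InKernel (restrict R x)
  restrict-InKernel {R} {x} R-closed x-ker = inKernel A·x′≡0
    where
    A·x′≡0 : ∀ i → A G i · restrict R x ≡ 0ℚ
    A·x′≡0 i with i ∈? R
    ... | yes i∈R = trans (∑-cong same-term) (proj₂ x-ker i tt)
      where
      same-term : ∀ j → A G i j * restrict R x j ≡ A G i j * x j
      same-term j with j ∈? R
      ... | yes _   = refl
      ... | no  j∉R = trans (*-zeroʳ (A G i j)) (sym (trans (cong (_* x j) (A≡0 G ij̸)) (*-zeroˡ (x j))))
        where ij̸ = λ ij → j∉R (R-closed i∈R ij)
    ... | no  i∉R = A·supported≡0 (restrict-∉ R x) (λ j∈R ij → i∉R (R-closed j∈R (Adjacent-sym G ij)))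

  isolated⇒core : ∀ {v} → (∀ u → ¬ Adjacent G v u) → CoreVertex G v
  isolated⇒core {v} isolated = e , inKernel (λ i → A·supported≡0 e-supp no-edge) , e-v≢0
    where
    basis = standardBasis ⁅ v ⁆ 1 (ℕ.≤-reflexive (sym (∣⁅x⁆∣≡1 v)))
    e = proj₁ basis zero
    e-supp : SupportedOn ⁅ v ⁆ e
    e-supp = proj₁ (proj₂ basis) zero
    no-edge : ∀ {i j} → j ∈ ⁅ v ⁆ → ¬ Adjacent G i j
    no-edge {i} j∈⁅v⁆ ij = isolated i (Adjacent-sym G (subst (Adjacent G i) (x∈⁅y⁆⇒x≡y v j∈⁅v⁆) ij))
    nonzero = LinIndep-singleton⇒nonzero (proj₁ basis) (proj₂ (proj₂ basis))
    e-v≢0 : e v ≢ 0ℚ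
    e-v≢0 e-v≡0 with proj₁ nonzero ∈? ⁅ v ⁆
    ... | yes w∈⁅v⁆ = proj₂ nonzero (subst (λ w → e w ≡ 0ℚ) (sym (x∈⁅y⁆⇒x≡y v w∈⁅v⁆)) e-v≡0)
    ... | no  w∉⁅v⁆ = proj₂ nonzero (e-supp _ w∉⁅v⁆)

  NullityAtMostOne : Set
  NullityAtMostOne = ∀ m → IndepKerFamilyOn G All m → m ≤ 1

  private
    ¬two-independent : NullityAtMostOne → ∀ {y z w₁ w₂} → InKernel y → InKernel z →
                       y w₁ ≢ 0ℚ → z w₁ ≡ 0ℚ → z w₂ ≢ 0ℚ → ⊥
    ¬two-independent η≤1 {y} {z} y-ker z-ker y≢0 z≡0 z≢0
      with η≤1 2 (y Vector.∷ z Vector.∷ Vector.[] , (λ { zero → y-ker ; (suc zero) → z-ker }) ,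
                  LinIndep-pair y z y≢0 z≡0 z≢0)
    ... | s≤s ()

  core⇒nonzero : NullityAtMostOne → ∀ {x w v} → InKernel x → x w ≢ 0ℚ → CoreVertex G v → x v ≢ 0ℚ
  core⇒nonzero η≤1 x-ker x-w≢0 (y , y-ker , y-v≢0) x-v≡0 = ¬two-independent η≤1 y-ker x-ker y-v≢0 x-v≡0 x-w≢0

  -- Restricting x to a component and to its complement would give two independent kernel vectors.
  connected : NullityAtMostOne → ∀ {x} → InKernel x →
              (∀ {R u} → Closed R → u ∈ R → ∃[ w ] (w ∈ R × x w ≢ 0ℚ)) → Connected G
  connected η≤1 {x} x-ker meets u v with component u
  ... | R , u∈R , R-closed , reach with v ∈? R
  ...   | yes v∈R = reach v∈R
  ...   | no  v∉R with meets R-closed u∈R | meets (∁-closed R-closed) (x∉p⇒x∈∁p v∉R)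
  ...     | w₁ , w₁∈R , x-w₁≢0 | w₂ , w₂∈∁R , x-w₂≢0 =
    ⊥-elim (¬two-independent η≤1 {w₁ = w₁} {w₂}
              (restrict-InKernel R-closed x-ker) (restrict-InKernel (∁-closed R-closed) x-ker)
              (λ eq → x-w₁≢0 (trans (sym (restrict-∈ R x w₁∈R)) eq))
              (restrict-∉ (∁ R) x w₁ (x∈p⇒x∉∁p w₁∈R))
              (λ eq → x-w₂≢0 (trans (sym (restrict-∈ (∁ R) x w₂∈∁R)) eq)))

module Bipartite {n} (G : Graph n) (V₁ : Subset n) (bip : Bipartition G V₁) where

  no-edge-within-V₁ : ∀ {u v} → u ∈ V₁ → v ∈ V₁ → ¬ Adjacent G u v
  no-edge-within-V₁ u∈V₁ v∈V₁ uv = [ (λ (_ , v∉V₁) → v∉V₁ v∈V₁) , (λ (u∉V₁ , _) → u∉V₁ u∈V₁) ]′ (bip _ _ uv)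

  no-edge-within-V₂ : ∀ {u v} → u ∉ V₁ → v ∉ V₁ → ¬ Adjacent G u v
  no-edge-within-V₂ u∉V₁ v∉V₁ uv = [ (λ (u∈V₁ , _) → u∉V₁ u∈V₁) , (λ (_ , v∈V₁) → v∉V₁ v∈V₁) ]′ (bip _ _ uv)

  neighbour-in-V₁ : ∀ {u v} → u ∉ V₁ → Adjacent G u v → v ∈ V₁
  neighbour-in-V₁ u∉V₁ uv = [ (λ (u∈V₁ , _) → contradiction u∈V₁ u∉V₁) , proj₂ ]′ (bip _ _ uv)

  -- On vectors supported on V₁ the rows indexed by V₁ vanish, leaving ∣ ∁ V₁ ∣ equations.
  kernel-on-V₁ : ∀ d → ∣ ∁ V₁ ∣ +ℕ d ≤ ∣ V₁ ∣ → IndepFamilyIn (λ x → SupportedOn V₁ x × InKernel G x) d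
  kernel-on-V₁ d d≤ = IndepFamilyIn-mono toKernel
    (cutByFunctionals (SupportedOn-subspace V₁) (A G) (∁ V₁) (standardBasis V₁ (∣ ∁ V₁ ∣ +ℕ d) d≤))
    where
    toKernel : ∀ x → SupportedOn V₁ x × Orthogonal (A G) (∁ V₁) x → SupportedOn V₁ x × InKernel G x
    toKernel x (x-supp , x⊥) = x-supp , inKernel G A·x≡0
      where
      A·x≡0 : ∀ i → A G i · x ≡ 0ℚ
      A·x≡0 i with i ∈? V₁
      ... | yes i∈V₁ = A·supported≡0 G x-supp (no-edge-within-V₁ i∈V₁)
      ... | no  i∉V₁ = x⊥ i (x∉p⇒x∈∁p i∉V₁)

  kernel-family : ∀ d → ∣ ∁ V₁ ∣ +ℕ d ≤ ∣ V₁ ∣ → IndepKerFamilyOn G All d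
  kernel-family d d≤ =
    IndepFamilyIn-mono {P = λ x → SupportedOn V₁ x × InKernel G x} (λ _ → proj₂) (kernel-on-V₁ d d≤)

module _ {n} (G : Graph n) (V₁ : Subset n) (bip : Bipartition G V₁) (V₁-larger : ∣ V₁ ∣ > ∣ ∁ V₁ ∣) where
  open Bipartite G V₁ bip

  private
    ∣V₂∣<∣V₁∣ : ∣ ∁ V₁ ∣ +ℕ 1 ≤ ∣ V₁ ∣
    ∣V₂∣<∣V₁∣ = subst (_≤ ∣ V₁ ∣) (ℕ.+-comm 1 _) V₁-larger
    x₀-family = kernel-on-V₁ 1 ∣V₂∣<∣V₁∣
    x₀ = proj₁ x₀-family zero
    x₀-supp : SupportedOn V₁ x₀
    x₀-supp = proj₁ (proj₁ (proj₂ x₀-family) zero)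
    x₀-ker : InKernel G x₀
    x₀-ker = proj₂ (proj₁ (proj₂ x₀-family) zero)
    x₀-nonzero = LinIndep-singleton⇒nonzero (proj₁ x₀-family) (proj₂ (proj₂ x₀-family))
    w₀ = proj₁ x₀-nonzero
    x₀-w₀≢0 : x₀ w₀ ≢ 0ℚ
    x₀-w₀≢0 = proj₂ x₀-nonzero

  nullity-of-K₁ : n ≡ 1 → Nullity G 1
  nullity-of-K₁ refl = kernel-family 1 ∣V₂∣<∣V₁∣ , λ m fam →
    subst (m ≤_) (∣⊤∣≡n 1) (IndepFamily-supported⇒≤ ⊤ (IndepFamilyIn-mono supported fam))
    where
    supported : ∀ x → InKernel G x → SupportedOn ⊤ x
    supported _ _ v v∉⊤ = contradiction ∈⊤ v∉⊤

  module _ (η≤1 : NullityAtMostOne G) where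

    ∣V₁∣≡1+∣V₂∣ : ∣ V₁ ∣ ≡ suc ∣ ∁ V₁ ∣
    ∣V₁∣≡1+∣V₂∣ = trans (sym ∣V₂∣+d≡∣V₁∣) (trans (cong (∣ ∁ V₁ ∣ +ℕ_) d≡1) (ℕ.+-comm ∣ ∁ V₁ ∣ 1))
      where
      d = ∣ V₁ ∣ ∸ ∣ ∁ V₁ ∣
      ∣V₂∣+d≡∣V₁∣ = ℕ.m+[n∸m]≡n (ℕ.<⇒≤ V₁-larger)
      d≡1 : d ≡ 1
      d≡1 = ℕ.≤-antisym (η≤1 d (kernel-family d (ℕ.≤-reflexive ∣V₂∣+d≡∣V₁∣)))
                        (ℕ.m<n⇒0<n∸m V₁-larger)

    n≡1+2∣V₂∣ : n ≡ suc ∣ ∁ V₁ ∣ +ℕ ∣ ∁ V₁ ∣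
    n≡1+2∣V₂∣ = trans (sym (∣p∣+∣∁p∣≡n V₁)) (cong (_+ℕ ∣ ∁ V₁ ∣) ∣V₁∣≡1+∣V₂∣)

    core⊆V₁ : ∀ {v} → CoreVertex G v → v ∈ V₁
    core⊆V₁ {v} v-core = decidable-stable (v ∈? V₁)
      (λ v∉V₁ → core⇒nonzero G η≤1 x₀-ker x₀-w₀≢0 v-core (x₀-supp v v∉V₁))

    V₂-has-neighbour : ∀ {v} → v ∉ V₁ → ∃[ u ] Adjacent G v u
    V₂-has-neighbour {v} v∉V₁ with Fin.any? (λ u → adj G v u Bool.≟ true)
    ... | yes neighbour = neighbour
    ... | no  isolated  = contradiction (core⊆V₁ (isolated⇒core G (λ u vu → isolated (u , vu)))) v∉V₁

    V₁⊆core⇒slim : (∀ {v} → v ∈ V₁ → CoreVertex G v) → Singular G → Slim G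
    V₁⊆core⇒slim V₁⊆core singular = connected G η≤1 x₀-ker meets , singular , core-independent , cfv⇔ncv
      where
      x₀-nonzero-on-V₁ : ∀ {v} → v ∈ V₁ → x₀ v ≢ 0ℚ
      x₀-nonzero-on-V₁ v∈V₁ = core⇒nonzero G η≤1 x₀-ker x₀-w₀≢0 (V₁⊆core v∈V₁)
      meets : ∀ {R u} → Closed G R → u ∈ R → ∃[ w ] (w ∈ R × x₀ w ≢ 0ℚ)
      meets {R} {u} R-closed u∈R with u ∈? V₁
      ... | yes u∈V₁ = u , u∈R , x₀-nonzero-on-V₁ u∈V₁
      ... | no  u∉V₁ with V₂-has-neighbour u∉V₁
      ...   | w , uw = w , R-closed u∈R uw , x₀-nonzero-on-V₁ (neighbour-in-V₁ u∉V₁ uw)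
      core-independent : Independent G (CoreVertex G)
      core-independent u v u-core v-core = no-edge-within-V₁ (core⊆V₁ u-core) (core⊆V₁ v-core)
      cfv⇔ncv : ∀ v → CoreForbidden G v ⇔ NeighbourOfCore G v
      cfv⇔ncv v = mk⇔ cfv⇒ncv (λ (u , u-core , uv) v-core → core-independent u v u-core v-core uv)
        where
        cfv⇒ncv : CoreForbidden G v → NeighbourOfCore G v
        cfv⇒ncv v-cf with V₂-has-neighbour (v-cf ∘ V₁⊆core)
        ... | u , vu = u , V₁⊆core (neighbour-in-V₁ (v-cf ∘ V₁⊆core) vu) , Adjacent-sym G vu

    ¬minimal-kernel-on-core : ∀ {v p} → v ∈ V₁ → ¬ CoreVertex G v →
                              HasCard (CoreForbidden G) p → ¬ NullityOn G (CoreVertex G) (suc p)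
    ¬minimal-kernel-on-core {v} {p} v∈V₁ v-cf (CF , ∈CF⇔cf , ∣CF∣≡p) (fam , _) =
      p<c≤q⇒p+c≢1+q+q 1+p≤∣CV∣ ∣CV∣≤∣V₂∣ p+∣CV∣≡n
      where
      supported : ∀ x → KerVecOn G (CoreVertex G) x → SupportedOn (∁ CF) x
      supported x (x-supp , _) w w∉∁CF = x-supp w (Equivalence.to (∈CF⇔cf w) (x∉∁p⇒x∈p w∉∁CF))
      1+p≤∣CV∣ : suc p ≤ ∣ ∁ CF ∣
      1+p≤∣CV∣ = IndepFamily-supported⇒≤ (∁ CF) (IndepFamilyIn-mono supported fam)
      ∁CF⊆V₁ : ∀ {w} → w ∈ ∁ CF → w ∈ V₁
      ∁CF⊆V₁ {w} w∈∁CF = decidable-stable (w ∈? V₁)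
        (λ w∉V₁ → x∈∁p⇒x∉p w∈∁CF (Equivalence.from (∈CF⇔cf w) (w∉V₁ ∘ core⊆V₁)))
      ∣CV∣≤∣V₂∣ : ∣ ∁ CF ∣ ≤ ∣ ∁ V₁ ∣
      ∣CV∣≤∣V₂∣ = ℕ.≤-pred (subst (∣ ∁ CF ∣ <_) ∣V₁∣≡1+∣V₂∣
        (p⊂q⇒∣p∣<∣q∣ (∁CF⊆V₁ , v , v∈V₁ , λ v∈∁CF → x∈∁p⇒x∉p v∈∁CF (Equivalence.from (∈CF⇔cf v) v-cf))))
      p+∣CV∣≡n : p +ℕ ∣ ∁ CF ∣ ≡ suc ∣ ∁ V₁ ∣ +ℕ ∣ ∁ V₁ ∣
      p+∣CV∣≡n = trans (cong (_+ℕ ∣ ∁ CF ∣) (sym ∣CF∣≡p)) (trans (∣p∣+∣∁p∣≡n CF) n≡1+2∣V₂∣)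

  minimal⇒nullity : MinimalConfiguration G → Nullity G 1
  minimal⇒nullity (_ , shape) = [ nullity-of-K₁ , (λ (_ , η≡1 , _) → η≡1) ]′ shape

  minimal⇒V₁⊆core : MinimalConfiguration G → ∀ {v} → v ∈ V₁ → CoreVertex G v
  minimal⇒V₁⊆core (_ , shape) {v} v∈V₁ with x₀ v ≟ 0ℚ | shape
  ... | no  x₀-v≢0 | _ = x₀ , x₀-ker , x₀-v≢0
  ... | yes x₀-v≡0 | inj₁ n≡1 =
    contradiction (subst (λ w → x₀ w ≡ 0ℚ) (Fin-singleton n≡1 v w₀) x₀-v≡0) x₀-w₀≢0
  ... | yes x₀-v≡0 | inj₂ (_ , η≡1 , _ , _ , ∣CFV∣≡p , η[CV]≡1+p) =
    ⊥-elim (¬minimal-kernel-on-core η≤1 v∈V₁ (λ v-core → core⇒nonzero G η≤1 x₀-ker x₀-w₀≢0 v-core x₀-v≡0)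
                                    ∣CFV∣≡p η[CV]≡1+p)
    where η≤1 = proj₂ η≡1

  minimal⇒slim : MinimalConfiguration G → Slim G × Nullity G 1 × (∀ v → CoreVertex G v ⇔ v ∈ V₁)
  minimal⇒slim mc@(singular , _) =
    V₁⊆core⇒slim η≤1 V₁⊆core singular , minimal⇒nullity mc , λ v → mk⇔ (core⊆V₁ η≤1) V₁⊆core
    where
    η≤1 = proj₂ (minimal⇒nullity mc)
    V₁⊆core = minimal⇒V₁⊆core mc

  slim⇒minimal : Slim G × Nullity G 1 × (∀ v → CoreVertex G v ⇔ v ∈ V₁) → MinimalConfiguration G
  slim⇒minimal ((_ , singular , _) , η≡1 , core⇔V₁) = singular , shape
    where
    q = ∣ ∁ V₁ ∣
    core⇒V₁ : ∀ {v} → CoreVertex G v → v ∈ V₁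
    core⇒V₁ {v} = Equivalence.to (core⇔V₁ v)
    V₁⇒core : ∀ {v} → v ∈ V₁ → CoreVertex G v
    V₁⇒core {v} = Equivalence.from (core⇔V₁ v)
    ∣V₁∣≡1+q = ∣V₁∣≡1+∣V₂∣ (proj₂ η≡1)

    cf-independent : Independent G (CoreForbidden G)
    cf-independent u v u-cf v-cf = no-edge-within-V₂ (u-cf ∘ V₁⇒core) (v-cf ∘ V₁⇒core)
    ∣CFV∣≡q : HasCard (CoreForbidden G) q
    ∣CFV∣≡q = ∁ V₁ , (λ v → mk⇔ (λ v∈V₂ v-core → x∈∁p⇒x∉p v∈V₂ (core⇒V₁ v-core))
                                (λ v-cf → x∉p⇒x∈∁p (v-cf ∘ V₁⇒core))) , refl

    -- G[CV] = G[V₁] has no edges, so its nullity is ∣ V₁ ∣.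
    η[CV]≡1+q : NullityOn G (CoreVertex G) (suc q)
    η[CV]≡1+q = IndepFamilyIn-mono in-kernel (standardBasis V₁ (suc q) (ℕ.≤-reflexive (sym ∣V₁∣≡1+q))) ,
                λ m fam →
                  subst (m ≤_) ∣V₁∣≡1+q (IndepFamily-supported⇒≤ V₁ (IndepFamilyIn-mono supported fam))
      where
      in-kernel : ∀ x → SupportedOn V₁ x → KerVecOn G (CoreVertex G) x
      in-kernel x x-supp = (λ w w-cf → x-supp w (w-cf ∘ V₁⇒core)) ,
                           (λ i i-core → A·supported≡0 G x-supp (no-edge-within-V₁ (core⇒V₁ i-core)))
      supported : ∀ x → KerVecOn G (CoreVertex G) x → SupportedOn V₁ x
      supported x (x-supp , _) w w∉V₁ = x-supp w (w∉V₁ ∘ core⇒V₁)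

    shape : n ≡ 1 ⊎ (3 ≤ n × Nullity G 1 × Independent G (CoreForbidden G) ×
                     ∃[ p ] (HasCard (CoreForbidden G) p × NullityOn G (CoreVertex G) (suc p)))
    shape with q ℕ.≟ 0
    ... | yes q≡0 = inj₁ (trans (n≡1+2∣V₂∣ (proj₂ η≡1)) (cong (λ q → suc q +ℕ q) q≡0))
    ... | no  q≢0 = inj₂ (3≤n , η≡1 , cf-independent , q , ∣CFV∣≡q , η[CV]≡1+q)
      where
      1≤q = ℕ.n≢0⇒n>0 q≢0
      3≤n : 3 ≤ n
      3≤n = subst (3 ≤_) (sym (n≡1+2∣V₂∣ (proj₂ η≡1))) (s≤s (ℕ.+-mono-≤ 1≤q 1≤q))

mainTheorem11 : ∀ {n} (G : Graph n) (V₁ : Subset n) → Bipartition G V₁ → ∣ V₁ ∣ > ∣ ∁ V₁ ∣ →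
                  MinimalConfiguration G ⇔ (Slim G × Nullity G 1 × (∀ v → CoreVertex G v ⇔ v ∈ V₁))
mainTheorem11 G V₁ bip V₁-larger = mk⇔ (minimal⇒slim G V₁ bip V₁-larger) (slim⇒minimal G V₁ bip V₁-larger)
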